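{- For all integers $0\le m\le n$, $$\sum_{k=m}^n s_{q,t}[n,k]\,S_{q,t}[k,m]=\delta_{m,n}\qquad\text{and}\qquad \sum_{k=m}^n S_{q,t}[n,k]\,s_{q,t}[k,m]=\delta_{m,n}.$$
   Context: Let $q,t$ be indeterminates. RG-words: $\mathcal R(n,k)$ is the set of words $w=w_1\cdots w_n$ of positive integers with $w_1=1$, $w_i\le\max(w_1,\dots,w_{i-1})+1$, and $\max_iw_i=k$; $\mathcal A(n,k)$ is the subset in which each even letter occurs exactly once. With $m_i=\max(w_1,\dots,w_i)$, $A(w)=\sum_{i\ge2}A_i(w)$ where $A_i(w)=w_i-1$ if $m_{i-1}\ge w_i$ and $0$ otherwise, and $B(w)=\#\{i\ge2: m_{i-1}>w_i\}$. For $n\ge1$, $1\le k\le n$ put $S_{q,t}[n,k]=\sum_{w\in\mathcal A(n,k)}q^{A(w)}t^{B(w)}$; also $S_{q,t}[n,0]=\delta_{n,0}$ and $S_{q,t}[n,k]=0$ for $k>n$. Rooks: the staircase board of length $n$ has squares $(i,j)$, $i,j\ge1$, $i+j\le n$ (row $i$ from top, column $j$ from left); square $(i,j)$ has $n-i-j$ squares below it in its column and is shaded if $n-i-j$ is even. $\mathcal{AR}(n,r)$ is the set of placements of $r$ rooks on shaded squares with no two in the same column; $\mathrm{below}(T)$ is the total number of squares below the rooks, $\mathrm{nrow}(T)$ the number of rooks not in row $1$. For $n\ge1$, $0\le k\le n$ put $s_{q,t}[n,k]=(-1)^{n-k}\sum_{T\in\mathcal{AR}(n,n-k)}q^{\mathrm{below}(T)}t^{\mathrm{nrow}(T)}$;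 also $s_{q,t}[0,0]=1$ and $s_{q,t}[n,k]=0$ for $k>n$. -}

module Defs where

open import Level using (Level)
open import Algebra.Bundles using (CommutativeRing)
open import Data.Bool using (Bool; true; false; _∧_; _∨_; not; if_then_else_)
open import Data.Nat using (ℕ; zero; suc; _+_; _∸_; _⊔_; _≤ᵇ_; _<ᵇ_; _≡ᵇ_)
open import Data.List using (List; []; _∷_; _++_; map; concatMap; filterᵇ; length; upTo; foldr)
open import Data.Product using (_×_; _,_)

evenᵇ : ℕ → Bool
evenᵇ zero          = true
evenᵇ (suc zero)    = false
evenᵇ (suc (suc n)) = evenᵇ n

oneTo : ℕ → List ℕ
oneTo a = map suc (upTo a)

words : ℕ → ℕ → List (List ℕ)
words zero    a = [] ∷ []
words (suc l) a = concatMap (λ x → map (x ∷_) (words l a)) (oneTo a)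

allᵇ : {A : Set} → (A → Bool) → List A → Bool
allᵇ p []       = true
allᵇ p (x ∷ xs) = p x ∧ allᵇ p xs

rgTail : ℕ → List ℕ → Bool
rgTail m []       = true
rgTail m (x ∷ xs) = (x ≤ᵇ suc m) ∧ rgTail (m ⊔ x) xs

isRG : List ℕ → Bool
isRG []       = false
isRG (x ∷ xs) = (x ≡ᵇ 1) ∧ rgTail x xs

maxW : List ℕ → ℕ
maxW = foldr _⊔_ 0

countW : ℕ → List ℕ → ℕ
countW x w = length (filterᵇ (x ≡ᵇ_) w)

evenOnce : List ℕ → Bool
evenOnce w = allᵇ (λ e → not (evenᵇ e) ∨ (countW e w ≡ᵇ 1)) w

-- 𝒜(n,k): RG-words of length n, max k, each even letter exactly once
-- (every such word has letters in {1,...,n})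
𝒜 : ℕ → ℕ → List (List ℕ)
𝒜 n k = filterᵇ (λ w → isRG w ∧ (maxW w ≡ᵇ k) ∧ evenOnce w) (words n n)

statAaux : ℕ → List ℕ → ℕ
statAaux m []       = 0
statAaux m (x ∷ xs) = (if x ≤ᵇ m then x ∸ 1 else 0) + statAaux (m ⊔ x) xs

statA : List ℕ → ℕ
statA []       = 0
statA (x ∷ xs) = statAaux x xs

statBaux : ℕ → List ℕ → ℕ
statBaux m []       = 0
statBaux m (x ∷ xs) = (if x <ᵇ m then 1 else 0) + statBaux (m ⊔ x) xs

statB : List ℕ → ℕ
statB []       = 0
statB (x ∷ xs) = statBaux x xs

-- A square is (i , j) = (row , column); a placement is a list of squares,
-- at most one per column (columns j = 1..n-1 are treated one at a time).
Square : Set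
Square = ℕ × ℕ

shadedRows : ℕ → ℕ → List ℕ
shadedRows n j = filterᵇ (λ i → evenᵇ (n ∸ i ∸ j)) (oneTo (n ∸ j))

placementsCols : ℕ → List ℕ → List (List Square)
placementsCols n []       = [] ∷ []
placementsCols n (j ∷ js) =
  let rest = placementsCols n js in
  rest ++ concatMap (λ i → map ((i , j) ∷_) rest) (shadedRows n j)

𝒜ℛ : ℕ → ℕ → List (List Square)
𝒜ℛ n r = filterᵇ (λ T → length T ≡ᵇ r) (placementsCols n (oneTo n))

below : ℕ → List Square → ℕ
below n []            = 0
below n ((i , j) ∷ T) = (n ∸ i ∸ j) + below n T

nrow : List Square → ℕ
nrow []            = 0
nrow ((i , j) ∷ T) = (if i ≡ᵇ 1 then 0 else 1) + nrow T

-- Polynomials in q,t are represented by evaluating in an arbitrary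
-- commutative ring R at arbitrary elements q t (an identity in ℤ[q,t]
-- holds iff it holds for all such evaluations).

module QT {c ℓ : Level} (R : CommutativeRing c ℓ) (q t : CommutativeRing.Carrier R) where
  open CommutativeRing R renaming (_+_ to _+R_; _*_ to _*R_)

  pow : Carrier → ℕ → Carrier
  pow x zero    = 1#
  pow x (suc k) = x *R pow x k

  sumR : List Carrier → Carrier
  sumR = foldr _+R_ 0#

  signed : ℕ → Carrier → Carrier
  signed zero    x = x
  signed (suc e) x = - signed e x

  δ : ℕ → ℕ → Carrier
  δ m n = if m ≡ᵇ n then 1# else 0#

  Sqt : ℕ → ℕ → Carrier
  Sqt zero    k = δ k 0
  Sqt (suc n) zero = 0#
  Sqt (suc n) (suc k) =
    if suc k ≤ᵇ suc n
    then sumR (map (λ w → pow q (statA w) *R pow t (statB w)) (𝒜 (suc n) (suc k)))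
    else 0#

  sqt : ℕ → ℕ → Carrier
  sqt zero    k = δ k 0
  sqt (suc n) k =
    if k ≤ᵇ suc n
    then signed (suc n ∸ k)
           (sumR (map (λ T → pow q (below (suc n) T) *R pow t (nrow T))
                      (𝒜ℛ (suc n) (suc n ∸ k))))
    else 0#

  sumFromTo : ℕ → ℕ → (ℕ → Carrier) → Carrier
  sumFromTo m n f = sumR (map (λ i → f (m + i)) (upTo (suc (n ∸ m))))

module Submission where

-- The two families S_{q,t} and s_{q,t} are generalised Stirling numbers of
-- the second and first kind for one and the same weight sequence
--   c_m = Σ_{x ≤ m, x odd} q^{x-1} t^{[x < m]},
-- and any such pair is a pair of mutually inverse triangular matrices.

open import Defs
open import Algebra.Bundles using (CommutativeRing)
open import Data.Bool using (Bool; true; false; T; not; _∧_; _∨_; if_then_else_)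
open import Data.Nat using (ℕ; zero; suc; _≤_; _<_; z≤n; s≤s; _∸_; _⊔_; _≡ᵇ_; _≤ᵇ_; _<ᵇ_) renaming (_+_ to _+ℕ_)
open import Data.List using (List; []; _∷_; _++_; map; concatMap; filterᵇ; foldr; length; upTo; applyUpTo; applyDownFrom)
open import Data.Product using (_×_; _,_)
open import Data.Sum using (inj₁; inj₂)
open import Data.Empty using (⊥-elim)
open import Function using (Equivalence)
open import Relation.Nullary.Decidable using (T?)
import Data.Nat.Properties as ℕ
import Data.Bool.Properties as 𝔹
import Data.List.Properties as List
import Relation.Binary.PropositionalEquality as ≡
open ≡ using (_≡_; _≢_)
import Algebra.Properties.CommutativeSemigroup as CommSemigroupProperties
import Algebra.Properties.AbelianGroup as AbelianGroupProperties
import Algebra.Properties.Ring as RingProperties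

module Sums {a ℓ} (R : CommutativeRing a ℓ) where
  open CommutativeRing R hiding (zero)
  open import Relation.Binary.Reasoning.Setoid setoid

  private
    module +-Props = CommSemigroupProperties +-commutativeSemigroup
    module *-Props = CommSemigroupProperties *-commutativeSemigroup

  *-swapˡ : ∀ x y z → x * (y * z) ≈ y * (x * z)
  *-swapˡ = *-Props.x∙yz≈y∙xz

  neg-+ : ∀ x y → - (x + y) ≈ - x + - y
  neg-+ x y = sym (AbelianGroupProperties.⁻¹-∙-comm +-abelianGroup x y)

  neg-*ʳ : ∀ x y → - (x * y) ≈ x * - y
  neg-*ʳ = RingProperties.-‿distribʳ-* ring

  −-*-distribʳ : ∀ x y z → (y - z) * x ≈ y * x - z * x
  −-*-distribʳ = RingProperties.[y-z]x≈yx-zx ring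

  neg-0 : - 0# ≈ 0#
  neg-0 = trans (sym (+-identityˡ (- 0#))) (-‿inverseʳ 0#)

  δ : ℕ → ℕ → Carrier
  δ m n = if m ≡ᵇ n then 1# else 0#

  δ-weight : (c : ℕ → Carrier) (m n : ℕ) → c m * δ m n ≈ c n * δ m n
  δ-weight c m n with m ≡ᵇ n in m≡ᵇn
  ... | true  = *-congʳ (reflexive (≡.cong c (ℕ.≡ᵇ⇒≡ m n (≡.subst T (≡.sym m≡ᵇn) _))))
  ... | false = trans (zeroʳ (c m)) (sym (zeroʳ (c n)))

  sumR : List Carrier → Carrier
  sumR = foldr _+_ 0#

  sum-++ : ∀ {A : Set} (f : A → Carrier) xs ys →
           sumR (map f (xs ++ ys)) ≈ sumR (map f xs) + sumR (map f ys)
  sum-++ f []       ys = sym (+-identityˡ _)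
  sum-++ f (x ∷ xs) ys = trans (+-congˡ (sum-++ f xs ys)) (sym (+-assoc _ _ _))

  sum-cong : ∀ {A : Set} {f g : A → Carrier} → (∀ x → f x ≈ g x) → ∀ xs →
             sumR (map f xs) ≈ sumR (map g xs)
  sum-cong f≈g []       = refl
  sum-cong f≈g (x ∷ xs) = +-cong (f≈g x) (sum-cong f≈g xs)

  sum-zero : ∀ {A : Set} {f : A → Carrier} → (∀ x → f x ≈ 0#) → ∀ xs →
             sumR (map f xs) ≈ 0#
  sum-zero f≈0 xs = trans (sum-cong f≈0 xs) (sum-zeros xs)
    where
    sum-zeros : ∀ {A : Set} (xs : List A) → sumR (map (λ _ → 0#) xs) ≈ 0#
    sum-zeros []       = refl
    sum-zeros (x ∷ xs) = trans (+-identityˡ _) (sum-zeros xs)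

  sum-scale : ∀ {A : Set} (k : Carrier) (f : A → Carrier) xs →
              sumR (map (λ x → k * f x) xs) ≈ k * sumR (map f xs)
  sum-scale k f []       = sym (zeroʳ k)
  sum-scale k f (x ∷ xs) = trans (+-congˡ (sum-scale k f xs)) (sym (distribˡ k _ _))

  sum-map : ∀ {A B : Set} (f : B → Carrier) (g : A → B) xs →
            sumR (map f (map g xs)) ≡ sumR (map (λ x → f (g x)) xs)
  sum-map f g []       = ≡.refl
  sum-map f g (x ∷ xs) = ≡.cong (f (g x) +_) (sum-map f g xs)

  sum-concatMap : ∀ {A B : Set} (f : B → Carrier) (g : A → List B) xs →
                  sumR (map f (concatMap g xs)) ≈ sumR (map (λ x → sumR (map f (g x))) xs)
  sum-concatMap f g []       = refl
  sum-concatMap f g (x ∷ xs) =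
    trans (sum-++ f (g x) (concatMap g xs)) (+-congˡ (sum-concatMap f g xs))

  sum-filter : ∀ {A : Set} (f : A → Carrier) (p : A → Bool) xs →
               sumR (map f (filterᵇ p xs)) ≈ sumR (map (λ x → if p x then f x else 0#) xs)
  sum-filter f p [] = refl
  sum-filter f p (x ∷ xs) with p x
  ... | true  = +-congˡ (sum-filter f p xs)
  ... | false = trans (sum-filter f p xs) (sym (+-identityˡ _))

  if-cong : ∀ b {x y} → x ≈ y → (if b then x else 0#) ≈ (if b then y else 0#)
  if-cong true  x≈y = x≈y
  if-cong false x≈y = refl

  if-scale : ∀ b x y → (if b then x * y else 0#) ≈ x * (if b then y else 0#)
  if-scale true  x y = refl
  if-scale false x y = sym (zeroʳ x)

  σ : (ℕ → Carrier) → ℕ → Carrier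
  σ f zero    = 0#
  σ f (suc n) = f 0 + σ (λ i → f (suc i)) n

  sum-applyUpTo : ∀ (f : ℕ → Carrier) (g : ℕ → ℕ) n →
                  sumR (map f (applyUpTo g n)) ≡ σ (λ i → f (g i)) n
  sum-applyUpTo f g zero    = ≡.refl
  sum-applyUpTo f g (suc n) = ≡.cong (f (g 0) +_) (sum-applyUpTo f (λ i → g (suc i)) n)

  σ-cong : ∀ {f g : ℕ → Carrier} n → (∀ i → i < n → f i ≈ g i) → σ f n ≈ σ g n
  σ-cong zero    f≈g = refl
  σ-cong (suc n) f≈g = +-cong (f≈g 0 (s≤s z≤n)) (σ-cong n (λ i i<n → f≈g (suc i) (s≤s i<n)))

  σ-zero : ∀ {f : ℕ → Carrier} n → (∀ i → i < n → f i ≈ 0#) → σ f n ≈ 0#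
  σ-zero zero    f≈0 = refl
  σ-zero (suc n) f≈0 =
    trans (+-cong (f≈0 0 (s≤s z≤n)) (σ-zero n (λ i i<n → f≈0 (suc i) (s≤s i<n)))) (+-identityˡ _)

  σ-last : ∀ (f : ℕ → Carrier) n → σ f (suc n) ≈ σ f n + f n
  σ-last f zero    = trans (+-identityʳ _) (sym (+-identityˡ _))
  σ-last f (suc n) = trans (+-congˡ (σ-last (λ i → f (suc i)) n)) (sym (+-assoc _ _ _))

  σ-drop-last : ∀ (f : ℕ → Carrier) n → f n ≈ 0# → σ f (suc n) ≈ σ f n
  σ-drop-last f n fn≈0 = trans (σ-last f n) (trans (+-congˡ fn≈0) (+-identityʳ _))

  σ-+ : ∀ (f g : ℕ → Carrier) n → σ (λ i → f i + g i) n ≈ σ f n + σ g n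
  σ-+ f g zero    = sym (+-identityˡ _)
  σ-+ f g (suc n) =
    trans (+-congˡ (σ-+ (λ i → f (suc i)) (λ i → g (suc i)) n)) (+-Props.interchange _ _ _ _)

  σ-scale : ∀ (k : Carrier) (f : ℕ → Carrier) n → σ (λ i → k * f i) n ≈ k * σ f n
  σ-scale k f zero    = sym (zeroʳ k)
  σ-scale k f (suc n) = trans (+-congˡ (σ-scale k _ n)) (sym (distribˡ k _ _))

  σ-neg : ∀ (f : ℕ → Carrier) n → σ (λ i → - f i) n ≈ - σ f n
  σ-neg f zero    = sym neg-0
  σ-neg f (suc n) = trans (+-congˡ (σ-neg _ n)) (sym (neg-+ _ _))

  σ-− : ∀ (f g : ℕ → Carrier) n → σ (λ i → f i - g i) n ≈ σ f n - σ g n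
  σ-− f g n = trans (σ-+ f (λ i → - g i) n) (+-congˡ (σ-neg g n))

  σ-split : ∀ (f : ℕ → Carrier) m d → σ f (m +ℕ d) ≈ σ f m + σ (λ i → f (m +ℕ i)) d
  σ-split f zero    d = sym (+-identityˡ _)
  σ-split f (suc m) d = trans (+-congˡ (σ-split (λ i → f (suc i)) m d)) (sym (+-assoc _ _ _))

  σ-extend : ∀ (f : ℕ → Carrier) n d → (∀ i → n ≤ i → f i ≈ 0#) → σ f (n +ℕ d) ≈ σ f n
  σ-extend f n d f≈0 = begin
    σ f (n +ℕ d)                         ≈⟨ σ-split f n d ⟩
    σ f n + σ (λ i → f (n +ℕ i)) d        ≈⟨ +-congˡ (σ-zero d (λ i _ → f≈0 (n +ℕ i) (ℕ.m≤m+n n i))) ⟩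
    σ f n + 0#                           ≈⟨ +-identityʳ _ ⟩
    σ f n                                ∎

  sum-from-to : ∀ (f : ℕ → Carrier) m n → m ≤ n → (∀ k → k < m → f k ≈ 0#) →
                sumR (map (λ i → f (m +ℕ i)) (upTo (suc (n ∸ m)))) ≈ σ f (suc n)
  sum-from-to f m n m≤n f≈0 = begin
    sumR (map (λ i → f (m +ℕ i)) (upTo (suc (n ∸ m))))
      ≡⟨ sum-applyUpTo (λ i → f (m +ℕ i)) (λ i → i) (suc (n ∸ m)) ⟩
    σ (λ i → f (m +ℕ i)) (suc (n ∸ m))
      ≈⟨ sym (trans (+-congʳ (σ-zero m f≈0)) (+-identityˡ _)) ⟩
    σ f m + σ (λ i → f (m +ℕ i)) (suc (n ∸ m))
      ≈⟨ σ-split f m (suc (n ∸ m)) ⟨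
    σ f (m +ℕ suc (n ∸ m))
      ≡⟨ ≡.cong (σ f) (≡.trans (ℕ.+-suc m (n ∸ m)) (≡.cong suc (ℕ.m+[n∸m]≡n m≤n))) ⟩
    σ f (suc n) ∎

  σ-reverse : ∀ (f : ℕ → Carrier) n → σ (λ i → f (n ∸ suc i)) n ≈ σ f n
  σ-reverse f zero    = refl
  σ-reverse f (suc n) = trans (+-congˡ (σ-reverse f n)) (trans (+-comm _ _) (sym (σ-last f n)))

  shift : (ℕ → Carrier) → ℕ → Carrier
  shift f zero    = 0#
  shift f (suc k) = f k

  shift-cong : ∀ {f g : ℕ → Carrier} → (∀ k → f k ≈ g k) → ∀ k → shift f k ≈ shift g k
  shift-cong f≈g zero    = refl
  shift-cong f≈g (suc k) = f≈g k

  shift-linear : ∀ (x : Carrier) (f g : ℕ → Carrier) k →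
                 shift (λ i → x * f i + g i) k ≈ x * shift f k + shift g k
  shift-linear x f g zero    = sym (trans (+-identityʳ _) (zeroʳ x))
  shift-linear x f g (suc k) = refl

  σ-shift : ∀ (a : ℕ → Carrier) (b : ℕ → ℕ → Carrier) n m →
            σ (λ j → a j * shift (b j) m) n ≈ shift (λ i → σ (λ j → a j * b j i) n) m
  σ-shift a b n zero    = σ-zero n (λ j _ → zeroʳ (a j))
  σ-shift a b n (suc m) = refl

  σ-shifted : ∀ (f g : ℕ → Carrier) n →
              σ (λ k → shift f k * g k) (suc n) ≈ σ (λ j → f j * g (suc j)) n
  σ-shifted f g n = trans (+-congʳ (zeroˡ (g 0))) (+-identityˡ _)

  shift-δ : ∀ n m → shift (λ i → δ i n) m ≡ δ m (suc n)
  shift-δ n zero    = ≡.refl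
  shift-δ n (suc m) = ≡.refl

  signed : ℕ → Carrier → Carrier
  signed zero    x = x
  signed (suc e) x = - signed e x

  signed-cong : ∀ e {x y} → x ≈ y → signed e x ≈ signed e y
  signed-cong zero    x≈y = x≈y
  signed-cong (suc e) x≈y = -‿cong (signed-cong e x≈y)

  signed-+ : ∀ e x y → signed e (x + y) ≈ signed e x + signed e y
  signed-+ zero    x y = refl
  signed-+ (suc e) x y = trans (-‿cong (signed-+ e x y)) (neg-+ _ _)

  signed-* : ∀ e x y → signed e (x * y) ≈ x * signed e y
  signed-* zero    x y = refl
  signed-* (suc e) x y = trans (-‿cong (signed-* e x y)) (neg-*ʳ x _)

  esym : List Carrier → ℕ → Carrier
  esym []       r = δ r 0
  esym (d ∷ ds) r = esym ds r + d * shift (esym ds) r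

  esym-∷-cong : ∀ {d e ds es} → d ≈ e → (∀ r → esym ds r ≈ esym es r) →
                ∀ r → esym (d ∷ ds) r ≈ esym (e ∷ es) r
  esym-∷-cong d≈e ds≈es r = +-cong (ds≈es r) (*-cong d≈e (shift-cong ds≈es r))

  esym-map-cong : ∀ {A : Set} {f g : A → Carrier} → (∀ x → f x ≈ g x) →
                  ∀ xs r → esym (map f xs) r ≈ esym (map g xs) r
  esym-map-cong f≈g []       r = refl
  esym-map-cong {f = f} {g} f≈g (x ∷ xs) r =
    esym-∷-cong {ds = map f xs} {es = map g xs} (f≈g x) (esym-map-cong f≈g xs) r

module Stirling {a ℓ} (R : CommutativeRing a ℓ) (c : ℕ → CommutativeRing.Carrier R) where
  open CommutativeRing R hiding (zero)
  open Sums R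
  open import Relation.Binary.Reasoning.Setoid setoid

  private
    module +-Props = CommSemigroupProperties +-commutativeSemigroup

  S : ℕ → ℕ → Carrier
  S zero    k = δ k 0
  S (suc n) k = shift (S n) k + c k * S n k

  s : ℕ → ℕ → Carrier
  s zero    k = δ k 0
  s (suc n) k = shift (s n) k - c n * s n k

  S-vanish : ∀ {n k} → n < k → S n k ≈ 0#
  S-vanish {zero}  {suc k} _         = refl
  S-vanish {suc n} {suc k} (s≤s n<k) =
    trans (+-cong (S-vanish n<k) (trans (*-congˡ (S-vanish (ℕ.m<n⇒m<1+n n<k))) (zeroʳ _)))
          (+-identityˡ _)

  s-vanish : ∀ {n k} → n < k → s n k ≈ 0#
  s-vanish {zero}  {suc k} _         = refl
  s-vanish {suc n} {suc k} (s≤s n<k) =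
    trans (+-cong (s-vanish n<k)
                  (trans (-‿cong (trans (*-congˡ (s-vanish (ℕ.m<n⇒m<1+n n<k))) (zeroʳ _))) neg-0))
          (+-identityˡ _)

  -- Σ_k s(n,k) S(k,m) = δ_{mn}, by induction on n: expanding s(n+1,k) and then
  -- S(k+1,m) leaves δ_{m,n+1} + c_m δ_{mn} - c_n δ_{mn}.
  s-S-inverse : ∀ n m → σ (λ k → s n k * S k m) (suc n) ≈ δ m n
  s-S-inverse zero    m = trans (+-identityʳ _) (*-identityˡ _)
  s-S-inverse (suc n) m = begin
    σ (λ k → s (suc n) k * S k m) (suc (suc n))
      ≈⟨ σ-cong (suc (suc n)) (λ k _ → trans (−-*-distribʳ (S k m) (shift (s n) k) (c n * s n k))
                                              (+-congˡ (-‿cong (*-assoc (c n) (s n k) (S k m))))) ⟩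
    σ (λ k → shift (s n) k * S k m - c n * (s n k * S k m)) (suc (suc n))
      ≈⟨ trans (σ-− (λ k → shift (s n) k * S k m) (λ k → c n * (s n k * S k m)) (suc (suc n)))
               (+-congˡ (-‿cong (σ-scale (c n) (λ k → s n k * S k m) (suc (suc n))))) ⟩
    σ (λ k → shift (s n) k * S k m) (suc (suc n)) - c n * σ (λ k → s n k * S k m) (suc (suc n))
      ≈⟨ +-cong new-row (-‿cong (*-congˡ old-row)) ⟩
    (δ m (suc n) + c m * δ m n) - c n * δ m n
      ≈⟨ trans (+-assoc _ _ _) (+-congˡ (trans (+-congʳ (δ-weight c m n)) (-‿inverseʳ _))) ⟩
    δ m (suc n) + 0#
      ≈⟨ +-identityʳ _ ⟩
    δ m (suc n) ∎
    where
    old-row : σ (λ k → s n k * S k m) (suc (suc n)) ≈ δ m n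
    old-row = trans (σ-drop-last (λ k → s n k * S k m) (suc n)
                                 (trans (*-congʳ (s-vanish (ℕ.n<1+n n))) (zeroˡ _)))
                    (s-S-inverse n m)
    new-row : σ (λ k → shift (s n) k * S k m) (suc (suc n)) ≈ δ m (suc n) + c m * δ m n
    new-row = begin
      σ (λ k → shift (s n) k * S k m) (suc (suc n))
        ≈⟨ σ-shifted (s n) (λ k → S k m) (suc n) ⟩
      σ (λ j → s n j * (shift (S j) m + c m * S j m)) (suc n)
        ≈⟨ σ-cong (suc n) (λ j _ → trans (distribˡ (s n j) (shift (S j) m) (c m * S j m))
                                           (+-congˡ (*-swapˡ (s n j) (c m) (S j m)))) ⟩
      σ (λ j → s n j * shift (S j) m + c m * (s n j * S j m)) (suc n)
        ≈⟨ trans (σ-+ (λ j → s n j * shift (S j) m) (λ j → c m * (s n j * S j m)) (suc n))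
                  (+-cong (σ-shift (s n) S (suc n) m) (σ-scale (c m) (λ j → s n j * S j m) (suc n))) ⟩
      shift (λ i → σ (λ j → s n j * S j i) (suc n)) m + c m * σ (λ j → s n j * S j m) (suc n)
        ≈⟨ +-cong (shift-cong (s-S-inverse n) m) (*-congˡ (s-S-inverse n m)) ⟩
      shift (λ i → δ i n) m + c m * δ m n
        ≡⟨ ≡.cong (_+ c m * δ m n) (shift-δ n m) ⟩
      δ m (suc n) + c m * δ m n ∎

  -- Σ_k S(n,k) s(k,m) = δ_{mn}: expanding S(n+1,k) and then s(k+1,m), the
  -- terms c_k S(n,k) s(k,m) cancel.
  S-s-inverse : ∀ n m → σ (λ k → S n k * s k m) (suc n) ≈ δ m n
  S-s-inverse zero    m = trans (+-identityʳ _) (*-identityˡ _)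
  S-s-inverse (suc n) m = begin
    σ (λ k → S (suc n) k * s k m) (suc (suc n))
      ≈⟨ σ-cong (suc (suc n)) (λ k _ → trans (distribʳ (s k m) (shift (S n) k) (c k * S n k))
                                              (+-congˡ (*-assoc (c k) (S n k) (s k m)))) ⟩
    σ (λ k → shift (S n) k * s k m + c k * (S n k * s k m)) (suc (suc n))
      ≈⟨ σ-+ (λ k → shift (S n) k * s k m) C (suc (suc n)) ⟩
    σ (λ k → shift (S n) k * s k m) (suc (suc n)) + σ C (suc (suc n))
      ≈⟨ +-cong new-row (σ-drop-last C (suc n) last-vanishes) ⟩
    (δ m (suc n) - σ C (suc n)) + σ C (suc n)
      ≈⟨ trans (+-assoc _ _ _) (trans (+-congˡ (-‿inverseˡ _)) (+-identityʳ _)) ⟩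
    δ m (suc n) ∎
    where
    C : ℕ → Carrier
    C k = c k * (S n k * s k m)
    last-vanishes : C (suc n) ≈ 0#
    last-vanishes = trans (*-congˡ (trans (*-congʳ (S-vanish (ℕ.n<1+n n))) (zeroˡ _))) (zeroʳ _)
    new-row : σ (λ k → shift (S n) k * s k m) (suc (suc n)) ≈ δ m (suc n) - σ C (suc n)
    new-row = begin
      σ (λ k → shift (S n) k * s k m) (suc (suc n))
        ≈⟨ σ-shifted (S n) (λ k → s k m) (suc n) ⟩
      σ (λ j → S n j * (shift (s j) m - c j * s j m)) (suc n)
        ≈⟨ σ-cong (suc n) (λ j _ → trans (distribˡ (S n j) (shift (s j) m) (- (c j * s j m)))
                                           (+-congˡ (trans (sym (neg-*ʳ (S n j) (c j * s j m)))
                                                           (-‿cong (*-swapˡ (S n j) (c j) (s j m)))))) ⟩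
      σ (λ j → S n j * shift (s j) m - C j) (suc n)
        ≈⟨ trans (σ-− (λ j → S n j * shift (s j) m) C (suc n)) (+-congʳ (σ-shift (S n) s (suc n) m)) ⟩
      shift (λ i → σ (λ j → S n j * s j i) (suc n)) m - σ C (suc n)
        ≈⟨ +-congʳ (shift-cong (S-s-inverse n) m) ⟩
      shift (λ i → δ i n) m - σ C (suc n)
        ≡⟨ ≡.cong (_- σ C (suc n)) (shift-δ n m) ⟩
      δ m (suc n) - σ C (suc n) ∎

  -- H l m K is the total weight of
  -- the l-step paths from level m to level K in which each step either stays
  -- at the current level k (weight c k) or climbs one level (weight 1).

  H : ℕ → ℕ → ℕ → Carrier
  H zero    m K = δ K m
  H (suc l) m K = c m * H l m K + H l (suc m) K

  -- Decomposing a path by its last step instead of its first one.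
  H-last-step : ∀ l m K → H (suc l) m K ≈ shift (H l m) K + c K * H l m K
  H-last-step zero m K = begin
    c m * δ K m + δ K (suc m)         ≈⟨ +-comm _ _ ⟩
    δ K (suc m) + c m * δ K m         ≈⟨ +-cong (reflexive (≡.sym (shift-δ m K))) (sym (δ-weight c K m)) ⟩
    shift (λ i → δ i m) K + c K * δ K m ∎
  H-last-step (suc l) m K = begin
    c m * H (suc l) m K + H (suc l) (suc m) K
      ≈⟨ +-cong (*-congˡ (H-last-step l m K)) (H-last-step l (suc m) K) ⟩
    c m * (shift (H l m) K + c K * H l m K) + (shift (H l (suc m)) K + c K * H l (suc m) K)
      ≈⟨ +-congʳ (trans (distribˡ (c m) _ _) (+-congˡ (*-swapˡ (c m) (c K) (H l m K)))) ⟩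
    (c m * shift (H l m) K + c K * (c m * H l m K)) + (shift (H l (suc m)) K + c K * H l (suc m) K)
      ≈⟨ +-Props.interchange _ _ _ _ ⟩
    (c m * shift (H l m) K + shift (H l (suc m)) K) + (c K * (c m * H l m K) + c K * H l (suc m) K)
      ≈⟨ +-cong (sym (shift-linear (c m) (H l m) (H l (suc m)) K)) (sym (distribˡ (c K) _ _)) ⟩
    shift (H (suc l) m) K + c K * H (suc l) m K ∎

  S≈H : ∀ n K → S n K ≈ H n 0 K
  S≈H zero    K = refl
  S≈H (suc n) K =
    trans (+-cong (shift-cong (S≈H n) K) (*-congˡ (S≈H n K))) (sym (H-last-step n 0 K))

  E : ℕ → ℕ → Carrier
  E n = esym (applyDownFrom c n)

  E-vanish : ∀ {n r} → n < r → E n r ≈ 0#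
  E-vanish {zero}  {suc r} _         = refl
  E-vanish {suc n} {suc r} (s≤s n<r) =
    trans (+-cong (E-vanish (ℕ.m<n⇒m<1+n n<r)) (trans (*-congˡ (E-vanish n<r)) (zeroʳ _)))
          (+-identityʳ _)

  E-zero : ∀ n → E n 0 ≈ 1#
  E-zero zero    = refl
  E-zero (suc n) = trans (+-cong (E-zero n) (zeroʳ (c n))) (+-identityʳ _)

  s-diagonal : ∀ n → s n n ≈ 1#
  s-diagonal zero    = refl
  s-diagonal (suc n) =
    trans (+-cong (s-diagonal n) (trans (-‿cong (trans (*-congˡ (s-vanish (ℕ.n<1+n n))) (zeroʳ _))) neg-0))
          (+-identityʳ _)

  s≈signedE-step : ∀ N d k →
    s (suc N) k ≈ signed (suc d) (E (suc N) (suc d)) →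
    s (suc N) (suc k) ≈ signed d (E (suc N) d) →
    s (suc (suc N)) (suc k) ≈ signed (suc d) (E (suc (suc N)) (suc d))
  s≈signedE-step N d k ih₁ ih₂ = begin
    s (suc N) k - c (suc N) * s (suc N) (suc k)
      ≈⟨ +-cong ih₁ (-‿cong (*-congˡ ih₂)) ⟩
    signed (suc d) (E (suc N) (suc d)) - c (suc N) * signed d (E (suc N) d)
      ≈⟨ +-congˡ (-‿cong (sym (signed-* d (c (suc N)) (E (suc N) d)))) ⟩
    signed (suc d) (E (suc N) (suc d)) + signed (suc d) (c (suc N) * E (suc N) d)
      ≈⟨ sym (signed-+ (suc d) _ _) ⟩
    signed (suc d) (E (suc (suc N)) (suc d)) ∎

  s≈signedE+ : ∀ d k → s (d +ℕ k) k ≈ signed d (E (d +ℕ k) d)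
  s≈signedE+ zero    k       = trans (s-diagonal k) (sym (E-zero k))
  s≈signedE+ (suc d) zero    = begin
    0# - c (d +ℕ 0) * s (d +ℕ 0) 0
      ≈⟨ trans (+-identityˡ _) (-‿cong (*-congˡ (s≈signedE+ d 0))) ⟩
    - (c (d +ℕ 0) * signed d (E (d +ℕ 0) d))
      ≈⟨ -‿cong (sym (signed-* d _ _)) ⟩
    - signed d (c (d +ℕ 0) * E (d +ℕ 0) d)
      ≈⟨ -‿cong (signed-cong d (sym (trans (+-congʳ (E-vanish d+0<1+d)) (+-identityˡ _)))) ⟩
    signed (suc d) (E (suc d +ℕ 0) (suc d)) ∎
    where
    d+0<1+d : d +ℕ 0 < suc d
    d+0<1+d = s≤s (ℕ.≤-reflexive (ℕ.+-identityʳ d))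
  s≈signedE+ (suc d) (suc k) =
    ≡.subst (λ N → s (suc N) (suc k) ≈ signed (suc d) (E (suc N) (suc d))) (≡.sym (ℕ.+-suc d k))
      (s≈signedE-step (d +ℕ k) d k (s≈signedE+ (suc d) k)
        (≡.subst (λ N → s N (suc k) ≈ signed d (E N d)) (ℕ.+-suc d k) (s≈signedE+ d (suc k))))

  s≈signedE : ∀ {n k} → k ≤ n → s n k ≈ signed (n ∸ k) (E n (n ∸ k))
  s≈signedE {n} {k} k≤n =
    ≡.subst (λ N → s N k ≈ signed (n ∸ k) (E N (n ∸ k))) (ℕ.m∸n+n≡m k≤n) (s≈signedE+ (n ∸ k) k)

module BooleanComparisons where
  open ≡ using (refl)

  true≢false : true ≢ false
  true≢false ()

  T⇒≡true : ∀ {b} → T b → b ≡ true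
  T⇒≡true = Equivalence.to 𝔹.T-≡

  ≤ᵇ-true : ∀ {m n} → m ≤ n → (m ≤ᵇ n) ≡ true
  ≤ᵇ-true m≤n = T⇒≡true (ℕ.≤⇒≤ᵇ m≤n)

  ≤ᵇ-false : ∀ {m n} → n < m → (m ≤ᵇ n) ≡ false
  ≤ᵇ-false {m} {n} n<m with m ≤ᵇ n in m≤ᵇn
  ... | false = refl
  ... | true  = ⊥-elim (ℕ.<⇒≱ n<m (ℕ.≤ᵇ⇒≤ m n (≡.subst T (≡.sym m≤ᵇn) _)))

  ≤ᵇ-true⇒≤ : ∀ {m n} → (m ≤ᵇ n) ≡ true → m ≤ n
  ≤ᵇ-true⇒≤ {m} {n} m≤ᵇn = ℕ.≤ᵇ⇒≤ m n (≡.subst T (≡.sym m≤ᵇn) _)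

  ≤ᵇ-false⇒> : ∀ {m n} → (m ≤ᵇ n) ≡ false → n < m
  ≤ᵇ-false⇒> m≰ᵇn = ℕ.≰⇒> (λ m≤n → true≢false (≡.trans (≡.sym (≤ᵇ-true m≤n)) m≰ᵇn))

  <ᵇ-true : ∀ {m n} → m < n → (m <ᵇ n) ≡ true
  <ᵇ-true = ≤ᵇ-true

  <ᵇ-false : ∀ {m n} → n ≤ m → (m <ᵇ n) ≡ false
  <ᵇ-false n≤m = ≤ᵇ-false (s≤s n≤m)

  ≡ᵇ-refl : ∀ n → (n ≡ᵇ n) ≡ true
  ≡ᵇ-refl n = T⇒≡true (ℕ.≡⇒≡ᵇ n n refl)

  ≡ᵇ-sym : ∀ m n → (m ≡ᵇ n) ≡ (n ≡ᵇ m)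
  ≡ᵇ-sym zero    zero    = refl
  ≡ᵇ-sym zero    (suc n) = refl
  ≡ᵇ-sym (suc m) zero    = refl
  ≡ᵇ-sym (suc m) (suc n) = ≡ᵇ-sym m n

  ≡ᵇ-sound : ∀ {m n} → (m ≡ᵇ n) ≡ true → m ≡ n
  ≡ᵇ-sound {m} {n} m≡ᵇn = ℕ.≡ᵇ⇒≡ m n (≡.subst T (≡.sym m≡ᵇn) _)

  ≡ᵇ-false : ∀ {m n} → m ≢ n → (m ≡ᵇ n) ≡ false
  ≡ᵇ-false {m} {n} m≢n with m ≡ᵇ n in m≡ᵇn
  ... | false = refl
  ... | true  = ⊥-elim (m≢n (≡ᵇ-sound m≡ᵇn))

  evenᵇ-suc : ∀ n → evenᵇ (suc n) ≡ not (evenᵇ n)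
  evenᵇ-suc zero    = refl
  evenᵇ-suc (suc n) = ≡.trans (≡.sym (𝔹.not-involutive (evenᵇ n))) (≡.cong not (≡.sym (evenᵇ-suc n)))

open BooleanComparisons

module LetterCounts where
  open ≡ using (refl)

  count-++ : ∀ e xs ys → countW e (xs ++ ys) ≡ countW e xs +ℕ countW e ys
  count-++ e xs ys =
    ≡.trans (≡.cong length (List.filter-++ (λ x → T? (e ≡ᵇ x)) xs ys)) (List.length-++ (filterᵇ (e ≡ᵇ_) xs))

  count-other : ∀ {e x} → e ≢ x → countW e (x ∷ []) ≡ 0
  count-other {e} {x} e≢x rewrite ≡ᵇ-false e≢x = refl

  count-self : ∀ x xs → countW x (x ∷ xs) ≡ suc (countW x xs)
  count-self x xs rewrite ≡ᵇ-refl x = refl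

  count-snoc-mono : ∀ e p x → countW e p ≤ countW e (p ++ x ∷ [])
  count-snoc-mono e p x rewrite count-++ e p (x ∷ []) = ℕ.m≤m+n _ _

  count-snoc-other : ∀ {e x} p → e ≢ x → countW e (p ++ x ∷ []) ≡ countW e p
  count-snoc-other {e} {x} p e≢x
    rewrite count-++ e p (x ∷ []) | count-other e≢x = ℕ.+-identityʳ (countW e p)

  count-absent : ∀ e xs → maxW xs < e → countW e xs ≡ 0
  count-absent e []       _ = refl
  count-absent e (x ∷ xs) max<e with e ≡ᵇ x in e≡ᵇx
  ... | true  = ⊥-elim (ℕ.<-irrefl (≡.sym (≡ᵇ-sound e≡ᵇx)) (ℕ.≤-<-trans (ℕ.m≤m⊔n x (maxW xs)) max<e))
  ... | false = count-absent e xs (ℕ.≤-<-trans (ℕ.m≤n⊔m x (maxW xs)) max<e)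

  maxW-snoc : ∀ p x → maxW (p ++ x ∷ []) ≡ maxW p ⊔ x
  maxW-snoc []      x = ℕ.⊔-identityʳ x
  maxW-snoc (y ∷ p) x = ≡.trans (≡.cong (y ⊔_) (maxW-snoc p x)) (≡.sym (ℕ.⊔-assoc y (maxW p) x))

  allᵇ-++ : ∀ (f : ℕ → Bool) xs ys → allᵇ f (xs ++ ys) ≡ allᵇ f xs ∧ allᵇ f ys
  allᵇ-++ f []       ys = refl
  allᵇ-++ f (x ∷ xs) ys = ≡.trans (≡.cong (f x ∧_) (allᵇ-++ f xs ys)) (≡.sym (𝔹.∧-assoc (f x) _ _))

  allᵇ-cong : ∀ {f g : ℕ → Bool} M → (∀ e → e ≤ M → f e ≡ g e) →
              ∀ xs → maxW xs ≤ M → allᵇ f xs ≡ allᵇ g xs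
  allᵇ-cong M f≡g []       _      = refl
  allᵇ-cong M f≡g (x ∷ xs) max≤M =
    ≡.cong₂ _∧_ (f≡g x (ℕ.≤-trans (ℕ.m≤m⊔n x (maxW xs)) max≤M))
                (allᵇ-cong M f≡g xs (ℕ.≤-trans (ℕ.m≤n⊔m x (maxW xs)) max≤M))

open LetterCounts

-- Only the letters ≤ m + 1 can be appended to it, and an
-- old even letter cannot be appended at all.
module GoodPrefixes where
  open ≡ using (refl)

  record Good (p : List ℕ) (m : ℕ) : Set where
    field
      max-is    : maxW p ≡ m
      even-once : evenOnce p ≡ true
      present   : ∀ e → 1 ≤ e → e ≤ m → 1 ≤ countW e p
  open Good public

  -- Every word of 𝒜 is a completion of the empty prefix.
  good-[] : Good [] 0
  good-[] = record { max-is = refl ; even-once = refl ; present = λ { (suc e) _ () } }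

  evenCondition : List ℕ → ℕ → Bool
  evenCondition w e = not (evenᵇ e) ∨ (countW e w ≡ᵇ 1)

  evenCondition-snoc : ∀ p x e → (evenᵇ e ≡ true → e ≢ x) →
                       evenCondition (p ++ x ∷ []) e ≡ evenCondition p e
  evenCondition-snoc p x e even⇒e≢x with evenᵇ e in even-e
  ... | false = refl
  ... | true  = ≡.cong (λ n → not true ∨ (n ≡ᵇ 1)) (count-snoc-other p (even⇒e≢x refl))

  evenOnce-snoc : ∀ p x → (∀ e → e ≤ maxW p → evenᵇ e ≡ true → e ≢ x) →
                  evenCondition (p ++ x ∷ []) x ≡ true → evenOnce p ≡ true →
                  evenOnce (p ++ x ∷ []) ≡ true
  evenOnce-snoc p x old-even≢x x-ok p-ok = begin
    allᵇ (evenCondition (p ++ x ∷ [])) (p ++ x ∷ [])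
      ≡⟨ allᵇ-++ (evenCondition (p ++ x ∷ [])) p (x ∷ []) ⟩
    allᵇ (evenCondition (p ++ x ∷ [])) p ∧ (evenCondition (p ++ x ∷ []) x ∧ true)
      ≡⟨ ≡.cong₂ (λ b b′ → b ∧ (b′ ∧ true))
           (allᵇ-cong (maxW p) (λ e e≤max → evenCondition-snoc p x e (old-even≢x e e≤max)) p ℕ.≤-refl)
           x-ok ⟩
    allᵇ (evenCondition p) p ∧ true
      ≡⟨ ≡.cong (_∧ true) p-ok ⟩
    true ∎
    where open ≡.≡-Reasoning

  good-snoc-odd : ∀ {p m x} → Good p m → x ≤ m → evenᵇ x ≡ false → Good (p ++ x ∷ []) m
  good-snoc-odd {p} {m} {x} g x≤m odd-x = record
    { max-is    = ≡.trans (maxW-snoc p x) (≡.trans (≡.cong (_⊔ x) (max-is g)) (ℕ.m≥n⇒m⊔n≡m x≤m))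
    ; even-once = evenOnce-snoc p x (λ { e _ even-e refl → true≢false (≡.trans (≡.sym even-e) odd-x) })
                    (≡.cong (λ b → not b ∨ (countW x (p ++ x ∷ []) ≡ᵇ 1)) odd-x) (even-once g)
    ; present   = λ e 1≤e e≤m → ℕ.≤-trans (present g e 1≤e e≤m) (count-snoc-mono e p x)
    }

  good-snoc-new : ∀ {p m} → Good p m → Good (p ++ suc m ∷ []) (suc m)
  good-snoc-new {p} {m} g = record
    { max-is    = ≡.trans (maxW-snoc p (suc m))
                          (≡.trans (≡.cong (_⊔ suc m) (max-is g)) (ℕ.m≤n⇒m⊔n≡n (ℕ.n≤1+n m)))
    ; even-once = evenOnce-snoc p (suc m) old≢new
                    (≡.trans (≡.cong (λ n → not (evenᵇ (suc m)) ∨ (n ≡ᵇ 1)) once) (𝔹.∨-zeroʳ _))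
                    (even-once g)
    ; present   = present′
    }
    where
    old≢new : ∀ e → e ≤ maxW p → evenᵇ e ≡ true → e ≢ suc m
    old≢new e e≤max _ refl = ℕ.<-irrefl (≡.sym (max-is g)) e≤max
    once : countW (suc m) (p ++ suc m ∷ []) ≡ 1
    once = ≡.trans (count-++ (suc m) p (suc m ∷ []))
                   (≡.cong₂ _+ℕ_ (count-absent (suc m) p (s≤s (ℕ.≤-reflexive (max-is g))))
                                 (count-self (suc m) []))
    present′ : ∀ e → 1 ≤ e → e ≤ suc m → 1 ≤ countW e (p ++ suc m ∷ [])
    present′ e 1≤e e≤1+m with ℕ.m≤n⇒m<n∨m≡n e≤1+m
    ... | inj₁ (s≤s e≤m) = ℕ.≤-trans (present g e 1≤e e≤m) (count-snoc-mono e p (suc m))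
    ... | inj₂ refl      = ℕ.≤-reflexive (≡.sym once)

  -- An old even letter cannot be appended: it would occur twice.
  evenOnce-snoc-even : ∀ {p m x} xs → Good p m → 1 ≤ x → x ≤ m → evenᵇ x ≡ true →
                       evenOnce ((p ++ x ∷ []) ++ xs) ≡ false
  evenOnce-snoc-even {p} {m} {x} xs g 1≤x x≤m even-x = begin
    allᵇ (evenCondition w) ((p ++ x ∷ []) ++ xs)
      ≡⟨ ≡.cong (allᵇ (evenCondition w)) (List.++-assoc p (x ∷ []) xs) ⟩
    allᵇ (evenCondition w) (p ++ x ∷ xs)
      ≡⟨ allᵇ-++ (evenCondition w) p (x ∷ xs) ⟩
    allᵇ (evenCondition w) p ∧ (evenCondition w x ∧ allᵇ (evenCondition w) xs)
      ≡⟨ ≡.cong (λ b → allᵇ (evenCondition w) p ∧ (b ∧ allᵇ (evenCondition w) xs)) x-fails ⟩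
    allᵇ (evenCondition w) p ∧ false
      ≡⟨ 𝔹.∧-zeroʳ _ ⟩
    false ∎
    where
    open ≡.≡-Reasoning
    w = (p ++ x ∷ []) ++ xs
    twice : countW x w ≡ countW x p +ℕ suc (countW x xs)
    twice = ≡.trans (≡.cong (countW x) (List.++-assoc p (x ∷ []) xs))
                    (≡.trans (count-++ x p (x ∷ xs)) (≡.cong (countW x p +ℕ_) (count-self x xs)))
    not-one : ∀ i j → 1 ≤ i → (i +ℕ suc j ≡ᵇ 1) ≡ false
    not-one (suc i) j _ rewrite ℕ.+-suc i j = refl
    x-fails : evenCondition w x ≡ false
    x-fails rewrite even-x | twice = not-one (countW x p) (countW x xs) (present g x 1≤x x≤m)

open GoodPrefixes

module Weights {a ℓ} (R : CommutativeRing a ℓ) (q t : CommutativeRing.Carrier R) where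
  open CommutativeRing R hiding (zero)
  open QT R q t using (pow)
  open Sums R

  mono : ℕ → ℕ → Carrier
  mono i j = pow q i * pow t j

  pow-+ : ∀ x i j → pow x (i +ℕ j) ≈ pow x i * pow x j
  pow-+ x zero    j = sym (*-identityˡ _)
  pow-+ x (suc i) j = trans (*-congˡ (pow-+ x i j)) (sym (*-assoc _ _ _))

  mono-+ : ∀ i j i′ j′ → mono (i +ℕ i′) (j +ℕ j′) ≈ mono i j * mono i′ j′
  mono-+ i j i′ j′ = trans (*-cong (pow-+ q i i′) (pow-+ t j j′))
                           (CommSemigroupProperties.interchange *-commutativeSemigroup _ _ _ _)

  -- The odd letter x = y + 1, repeated below the current maximum m, has
  -- weight q^{x-1} t^{[x < m]}; even letters cannot be repeated.
  oddLetterWeight : ℕ → ℕ → Carrier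
  oddLetterWeight m y = if evenᵇ (suc y) then 0# else mono y (if suc y <ᵇ m then 1 else 0)

  oddWeight : ℕ → Carrier
  oddWeight m = σ (oddLetterWeight m) m

module RGWords {a ℓ} (R : CommutativeRing a ℓ) (q t : CommutativeRing.Carrier R) where
  open CommutativeRing R hiding (zero)
  open QT R q t using (Sqt)
  open Sums R
  open Weights R q t
  open Stirling R oddWeight using (S; H; S≈H; S-vanish)
  open import Relation.Binary.Reasoning.Setoid setoid

  -- Appending x to a prefix of maximum m multiplies the weight by q^{A} t^{B}.
  letterWeight : ℕ → ℕ → Carrier
  letterWeight m x = mono (if x ≤ᵇ m then x ∸ 1 else 0) (if x <ᵇ m then 1 else 0)

  tailWeight : ℕ → List ℕ → Carrier
  tailWeight m xs = mono (statAaux m xs) (statBaux m xs)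

  tailWeight-∷ : ∀ m x xs → tailWeight m (x ∷ xs) ≈ letterWeight m x * tailWeight (m ⊔ x) xs
  tailWeight-∷ m x xs =
    mono-+ (if x ≤ᵇ m then x ∸ 1 else 0) (if x <ᵇ m then 1 else 0) (statAaux (m ⊔ x) xs) (statBaux (m ⊔ x) xs)

  admissible : List ℕ → ℕ → ℕ → List ℕ → Bool
  admissible p m K xs = rgTail m xs ∧ (maxW (p ++ xs) ≡ᵇ K) ∧ evenOnce (p ++ xs)

  admissible-∷ : ∀ p m K x xs →
    admissible p m K (x ∷ xs) ≡ (x ≤ᵇ suc m) ∧ admissible (p ++ x ∷ []) (m ⊔ x) K xs
  admissible-∷ p m K x xs rewrite List.++-assoc p (x ∷ []) xs = 𝔹.∧-assoc (x ≤ᵇ suc m) _ _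

  summand : List ℕ → ℕ → ℕ → List ℕ → Carrier
  summand p m K xs = if admissible p m K xs then tailWeight m xs else 0#

  completionSum : ℕ → ℕ → List ℕ → ℕ → ℕ → Carrier
  completionSum l a p m K = sumR (map (summand p m K) (words l a))

  sum-words-suc : ∀ (g : List ℕ → Carrier) l a →
    sumR (map g (words (suc l) a)) ≈ σ (λ y → sumR (map (λ xs → g (suc y ∷ xs)) (words l a))) a
  sum-words-suc g l a = begin
    sumR (map g (concatMap (λ x → map (x ∷_) (words l a)) (map suc (upTo a))))
      ≈⟨ sum-concatMap g (λ x → map (x ∷_) (words l a)) (map suc (upTo a)) ⟩
    sumR (map (λ x → sumR (map g (map (x ∷_) (words l a)))) (map suc (upTo a)))
      ≡⟨ ≡.trans (sum-map _ suc (upTo a)) (sum-applyUpTo _ (λ i → i) a) ⟩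
    σ (λ y → sumR (map g (map (suc y ∷_) (words l a)))) a
      ≈⟨ σ-cong a (λ y _ → reflexive (sum-map g (suc y ∷_) (words l a))) ⟩
    σ (λ y → sumR (map (λ xs → g (suc y ∷ xs)) (words l a))) a ∎

  startingWith : ℕ → ℕ → List ℕ → ℕ → ℕ → ℕ → Carrier
  startingWith l a p m K y = sumR (map (λ xs → summand p m K (suc y ∷ xs)) (words l a))

  startingWith-factor : ∀ l a p m K y → y ≤ m →
    startingWith l a p m K y ≈ letterWeight m (suc y) * completionSum l a (p ++ suc y ∷ []) (m ⊔ suc y) K
  startingWith-factor l a p m K y y≤m =
    trans (sum-cong factor (words l a)) (sum-scale _ _ (words l a))
    where
    factor : ∀ xs → summand p m K (suc y ∷ xs)
                      ≈ letterWeight m (suc y) * summand (p ++ suc y ∷ []) (m ⊔ suc y) K xs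
    factor xs rewrite admissible-∷ p m K (suc y) xs | ≤ᵇ-true (s≤s y≤m)
      with admissible (p ++ suc y ∷ []) (m ⊔ suc y) K xs
    ... | true  = tailWeight-∷ m (suc y) xs
    ... | false = sym (zeroʳ _)

  -- Letters beyond m + 1 violate the restricted-growth condition.
  startingWith-too-large : ∀ l a p m K y → suc m ≤ y → startingWith l a p m K y ≈ 0#
  startingWith-too-large l a p m K y 1+m≤y = sum-zero vanish (words l a)
    where
    vanish : ∀ xs → summand p m K (suc y ∷ xs) ≈ 0#
    vanish xs rewrite admissible-∷ p m K (suc y) xs | ≤ᵇ-false (s≤s 1+m≤y) = refl

  startingWith-old : ∀ l a p m K y → Good p m → y < m → ∀ {X} →
    (Good (p ++ suc y ∷ []) m → completionSum l a (p ++ suc y ∷ []) m K ≈ X) →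
    startingWith l a p m K y ≈ oddLetterWeight m y * X
  startingWith-old l a p m K y g y<m {X} recurse with evenᵇ (suc y) in parity
  ... | false = begin
    startingWith l a p m K y
      ≈⟨ startingWith-factor l a p m K y (ℕ.<⇒≤ y<m) ⟩
    letterWeight m (suc y) * completionSum l a (p ++ suc y ∷ []) (m ⊔ suc y) K
      ≡⟨ ≡.cong₂ (λ b n → mono (if b then y else 0) (if suc y <ᵇ m then 1 else 0)
                              * completionSum l a (p ++ suc y ∷ []) n K)
                 (≤ᵇ-true y<m) (ℕ.m≥n⇒m⊔n≡m y<m) ⟩
    mono y (if suc y <ᵇ m then 1 else 0) * completionSum l a (p ++ suc y ∷ []) m K
      ≈⟨ *-congˡ (recurse (good-snoc-odd g y<m parity)) ⟩
    mono y (if suc y <ᵇ m then 1 else 0) * X ∎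
  ... | true = begin
    startingWith l a p m K y
      ≈⟨ startingWith-factor l a p m K y (ℕ.<⇒≤ y<m) ⟩
    letterWeight m (suc y) * completionSum l a (p ++ suc y ∷ []) (m ⊔ suc y) K
      ≈⟨ trans (*-congˡ (sum-zero dead (words l a))) (zeroʳ _) ⟩
    0#
      ≈⟨ sym (zeroˡ X) ⟩
    0# * X ∎
    where
    dead : ∀ xs → summand (p ++ suc y ∷ []) (m ⊔ suc y) K xs ≈ 0#
    dead xs rewrite evenOnce-snoc-even xs g (s≤s z≤n) y<m parity
                  | 𝔹.∧-zeroʳ (maxW ((p ++ suc y ∷ []) ++ xs) ≡ᵇ K)
                  | 𝔹.∧-zeroʳ (rgTail (m ⊔ suc y) xs) = refl

  startingWith-new : ∀ l a p m K →
    startingWith l a p m K m ≈ completionSum l a (p ++ suc m ∷ []) (suc m) K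
  startingWith-new l a p m K = begin
    startingWith l a p m K m
      ≈⟨ startingWith-factor l a p m K m ℕ.≤-refl ⟩
    letterWeight m (suc m) * completionSum l a (p ++ suc m ∷ []) (m ⊔ suc m) K
      ≡⟨ ≡.cong₂ (λ b b′ → mono (if b then m else 0) (if b′ then 1 else 0)
                               * completionSum l a (p ++ suc m ∷ []) (m ⊔ suc m) K)
                 (≤ᵇ-false {suc m} {m} ℕ.≤-refl) (<ᵇ-false {suc m} {m} (ℕ.n≤1+n m)) ⟩
    mono 0 0 * completionSum l a (p ++ suc m ∷ []) (m ⊔ suc m) K
      ≡⟨ ≡.cong (λ n → mono 0 0 * completionSum l a (p ++ suc m ∷ []) n K)
                (ℕ.m≤n⇒m⊔n≡n (ℕ.n≤1+n m)) ⟩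
    (1# * 1#) * completionSum l a (p ++ suc m ∷ []) (suc m) K
      ≈⟨ trans (*-congʳ (*-identityˡ 1#)) (*-identityˡ _) ⟩
    completionSum l a (p ++ suc m ∷ []) (suc m) K ∎

  completionSum-[] : ∀ a p m K → Good p m → completionSum 0 a p m K ≈ δ K m
  completionSum-[] a p m K g = begin
    summand p m K [] + 0#                ≈⟨ +-identityʳ _ ⟩
    summand p m K []                     ≡⟨ ≡.cong (λ b → if b then 1# * 1# else 0#) complete ⟩
    (if K ≡ᵇ m then 1# * 1# else 0#)     ≈⟨ unit (K ≡ᵇ m) ⟩
    δ K m                                ∎
    where
    complete : admissible p m K [] ≡ (K ≡ᵇ m)
    complete rewrite List.++-identityʳ p | max-is g | even-once g = ≡.trans (𝔹.∧-identityʳ _) (≡ᵇ-sym m K)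
    unit : ∀ b → (if b then 1# * 1# else 0#) ≈ (if b then 1# else 0#)
    unit true  = *-identityˡ 1#
    unit false = refl

  -- The completions of a good prefix are counted by lattice paths: the first
  -- letter either repeats an odd letter (weight c_m) or is the new letter m + 1.
  completionSum≈H : ∀ l a p m K → Good p m → m +ℕ l ≤ a → completionSum l a p m K ≈ H l m K
  completionSum≈H zero    a p m K g _        = completionSum-[] a p m K g
  completionSum≈H (suc l) a p m K g m+1+l≤a = begin
    completionSum (suc l) a p m K
      ≈⟨ sum-words-suc (summand p m K) l a ⟩
    σ F a
      ≡⟨ ≡.cong (σ F) (≡.sym (ℕ.m+[n∸m]≡n 1+m≤a)) ⟩
    σ F (suc m +ℕ (a ∸ suc m))
      ≈⟨ σ-extend F (suc m) (a ∸ suc m) (startingWith-too-large l a p m K) ⟩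
    σ F (suc m)
      ≈⟨ σ-last F m ⟩
    σ F m + F m
      ≈⟨ +-cong (σ-cong m old) new ⟩
    σ (λ y → oddLetterWeight m y * H l m K) m + H l (suc m) K
      ≈⟨ +-congʳ (trans (σ-cong m (λ y _ → *-comm (oddLetterWeight m y) (H l m K)))
                        (trans (σ-scale (H l m K) (oddLetterWeight m) m) (*-comm _ _))) ⟩
    oddWeight m * H l m K + H l (suc m) K ∎
    where
    F : ℕ → Carrier
    F = startingWith l a p m K
    m+l≤a : m +ℕ l ≤ a
    m+l≤a = ℕ.≤-trans (ℕ.+-monoʳ-≤ m (ℕ.n≤1+n l)) m+1+l≤a
    1+m+l≤a : suc m +ℕ l ≤ a
    1+m+l≤a = ≡.subst (_≤ a) (ℕ.+-suc m l) m+1+l≤a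
    1+m≤a : suc m ≤ a
    1+m≤a = ℕ.≤-trans (ℕ.m≤m+n (suc m) l) 1+m+l≤a
    old : ∀ y → y < m → F y ≈ oddLetterWeight m y * H l m K
    old y y<m = startingWith-old l a p m K y g y<m (λ g′ → completionSum≈H l a _ m K g′ m+l≤a)
    new : F m ≈ H l (suc m) K
    new = trans (startingWith-new l a p m K) (completionSum≈H l a _ (suc m) K (good-snoc-new g) 1+m+l≤a)

  -- The weight of 𝒜(n + 1, K) is the completion sum of the empty prefix: a
  -- first letter 1 is exactly a letter not exceeding 0 + 1.
  𝒜-weight : ∀ n K → sumR (map (λ w → mono (statA w) (statB w)) (𝒜 (suc n) K))
                      ≈ completionSum (suc n) (suc n) [] 0 K
  𝒜-weight n K = begin
    sumR (map wt (filterᵇ Φ (words (suc n) (suc n))))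
      ≈⟨ sum-filter wt Φ (words (suc n) (suc n)) ⟩
    sumR (map (λ w → if Φ w then wt w else 0#) (words (suc n) (suc n)))
      ≈⟨ sum-words-suc (λ w → if Φ w then wt w else 0#) n (suc n) ⟩
    σ (λ y → sumR (map (λ xs → if Φ (suc y ∷ xs) then wt (suc y ∷ xs) else 0#) (words n (suc n)))) (suc n)
      ≈⟨ σ-cong (suc n) (λ y _ → sum-cong (λ xs → reflexive (first-letter y xs)) (words n (suc n))) ⟩
    σ (startingWith n (suc n) [] 0 K) (suc n)
      ≈⟨ sym (sum-words-suc (summand [] 0 K) n (suc n)) ⟩
    completionSum (suc n) (suc n) [] 0 K ∎
    where
    wt : List ℕ → Carrier
    wt w = mono (statA w) (statB w)
    Φ : List ℕ → Bool
    Φ w = isRG w ∧ (maxW w ≡ᵇ K) ∧ evenOnce w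
    first-letter : ∀ y xs → (if Φ (suc y ∷ xs) then wt (suc y ∷ xs) else 0#) ≡ summand [] 0 K (suc y ∷ xs)
    first-letter zero    xs = ≡.refl
    first-letter (suc y) xs = ≡.refl

  Sqt≈S : ∀ n k → Sqt n k ≈ S n k
  Sqt≈S zero    k       = refl
  Sqt≈S (suc n) zero    = sym (trans (+-identityˡ _) (zeroˡ _))
  Sqt≈S (suc n) (suc k) with suc k ≤ᵇ suc n in k≤ᵇn
  ... | true  = begin
    sumR (map (λ w → mono (statA w) (statB w)) (𝒜 (suc n) (suc k)))
      ≈⟨ 𝒜-weight n (suc k) ⟩
    completionSum (suc n) (suc n) [] 0 (suc k)
      ≈⟨ completionSum≈H (suc n) (suc n) [] 0 (suc k) good-[] ℕ.≤-refl ⟩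
    H (suc n) 0 (suc k)
      ≈⟨ S≈H (suc n) (suc k) ⟨
    S (suc n) (suc k) ∎
  ... | false = sym (S-vanish {suc n} {suc k} (≤ᵇ-false⇒> k≤ᵇn))

module Rooks {a ℓ} (R : CommutativeRing a ℓ) (q t : CommutativeRing.Carrier R) where
  open CommutativeRing R hiding (zero)
  open QT R q t using (sqt) renaming (signed to signedQT)
  open Sums R
  open Weights R q t
  open Stirling R oddWeight using (s; E; s≈signedE; s-vanish)
  open import Relation.Binary.Reasoning.Setoid setoid

  rookWeight : ℕ → ℕ → ℕ → Carrier
  rookWeight N j i = mono (N ∸ i ∸ j) (if i ≡ᵇ 1 then 0 else 1)

  placementWeight : ℕ → List Square → Carrier
  placementWeight N T = mono (below N T) (nrow T)

  placementWeight-∷ : ∀ N i j T → placementWeight N ((i , j) ∷ T) ≈ rookWeight N j i * placementWeight N T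
  placementWeight-∷ N i j T = mono-+ (N ∸ i ∸ j) (if i ≡ᵇ 1 then 0 else 1) (below N T) (nrow T)

  columnWeight : ℕ → ℕ → Carrier
  columnWeight N j = sumR (map (rookWeight N j) (shadedRows N j))

  placementSum : ℕ → List ℕ → ℕ → Carrier
  placementSum N js r =
    sumR (map (λ T → if length T ≡ᵇ r then placementWeight N T else 0#) (placementsCols N js))

  sum-length-suc : ∀ (f : List Square → Carrier) Ts r →
    sumR (map (λ T → if suc (length T) ≡ᵇ r then f T else 0#) Ts)
      ≈ shift (λ r′ → sumR (map (λ T → if length T ≡ᵇ r′ then f T else 0#) Ts)) r
  sum-length-suc f Ts zero    = sum-zero (λ _ → refl) Ts
  sum-length-suc f Ts (suc r) = refl

  -- Columns are independent: a placement is a choice of at most one rook per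
  -- column, so the weights are elementary symmetric in the column weights.
  placementSum≈esym : ∀ N js r → placementSum N js r ≈ esym (map (columnWeight N) js) r
  placementSum≈esym N []       zero    = trans (+-identityʳ _) (*-identityˡ 1#)
  placementSum≈esym N []       (suc r) = +-identityʳ _
  placementSum≈esym N (j ∷ js) r       = begin
    sumR (map F (rest ++ concatMap (λ i → map ((i , j) ∷_) rest) rows))
      ≈⟨ sum-++ F rest _ ⟩
    placementSum N js r + sumR (map F (concatMap (λ i → map ((i , j) ∷_) rest) rows))
      ≈⟨ +-cong (placementSum≈esym N js r) (sum-concatMap F (λ i → map ((i , j) ∷_) rest) rows) ⟩
    esym (map (columnWeight N) js) r + sumR (map (λ i → sumR (map F (map ((i , j) ∷_) rest))) rows)
      ≈⟨ +-congˡ (sum-cong (λ i → trans (reflexive (sum-map F ((i , j) ∷_) rest)) (rook-in-row i)) rows) ⟩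
    esym (map (columnWeight N) js) r + sumR (map (λ i → rookWeight N j i * shifted) rows)
      ≈⟨ +-congˡ (trans (sum-cong (λ i → *-comm (rookWeight N j i) shifted) rows)
                        (trans (sum-scale shifted (rookWeight N j) rows) (*-comm _ _))) ⟩
    esym (map (columnWeight N) js) r + columnWeight N j * shifted
      ≈⟨ +-congˡ (*-congˡ (shift-cong (placementSum≈esym N js) r)) ⟩
    esym (map (columnWeight N) (j ∷ js)) r ∎
    where
    rest = placementsCols N js
    rows = shadedRows N j
    F : List Square → Carrier
    F T = if length T ≡ᵇ r then placementWeight N T else 0#
    shifted : Carrier
    shifted = shift (placementSum N js) r
    rook-in-row : ∀ i → sumR (map (λ T → F ((i , j) ∷ T)) rest) ≈ rookWeight N j i * shifted
    rook-in-row i = begin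
      sumR (map (λ T → F ((i , j) ∷ T)) rest)
        ≈⟨ sum-cong (λ T → trans (if-cong (suc (length T) ≡ᵇ r) (placementWeight-∷ N i j T))
                                 (if-scale (suc (length T) ≡ᵇ r) _ _)) rest ⟩
      sumR (map (λ T → rookWeight N j i * (if suc (length T) ≡ᵇ r then placementWeight N T else 0#)) rest)
        ≈⟨ sum-scale (rookWeight N j i) _ rest ⟩
      rookWeight N j i * sumR (map (λ T → if suc (length T) ≡ᵇ r then placementWeight N T else 0#) rest)
        ≈⟨ *-congˡ (sum-length-suc (placementWeight N) rest r) ⟩
      rookWeight N j i * shifted ∎

  -- A rook in row i above d squares, counted only if its square is shaded.
  squareWeight : ℕ → ℕ → Carrier
  squareWeight d i = if evenᵇ d then mono d (if i ≡ᵇ 1 then 0 else 1) else 0#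

  -- The weight of a column of height h, whose row i has h - i squares below.
  columnSum : ℕ → Carrier
  columnSum h = sumR (map (λ i → squareWeight (h ∸ i) i) (oneTo h))

  columnWeight≈columnSum : ∀ N j → columnWeight N j ≈ columnSum (N ∸ j)
  columnWeight≈columnSum N j = begin
    sumR (map (rookWeight N j) (filterᵇ (λ i → evenᵇ (N ∸ i ∸ j)) (oneTo (N ∸ j))))
      ≈⟨ sum-filter (rookWeight N j) (λ i → evenᵇ (N ∸ i ∸ j)) (oneTo (N ∸ j)) ⟩
    sumR (map (λ i → if evenᵇ (N ∸ i ∸ j) then rookWeight N j i else 0#) (oneTo (N ∸ j)))
      ≈⟨ sum-cong (λ i → reflexive (≡.cong (λ d → squareWeight d i) (∸-swap i))) (oneTo (N ∸ j)) ⟩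
    columnSum (N ∸ j) ∎
    where
    ∸-swap : ∀ i → N ∸ i ∸ j ≡ N ∸ j ∸ i
    ∸-swap i = ≡.trans (ℕ.∸-+-assoc N i j)
                       (≡.trans (≡.cong (N ∸_) (ℕ.+-comm i j)) (≡.sym (ℕ.∸-+-assoc N j i)))

  -- In a column of height n, row z + 1 has y = n - 1 - z squares below it and
  -- weight q^y t^{[z ≠ 0]}: this is the weight of the odd letter y + 1, which
  -- lies below the maximum n exactly when z ≠ 0.  Summing over z in reverse
  -- order gives c_n.
  columnSum≈oddWeight : ∀ n → columnSum n ≈ oddWeight n
  columnSum≈oddWeight n = begin
    sumR (map (λ i → squareWeight (n ∸ i) i) (map suc (upTo n)))
      ≡⟨ ≡.trans (sum-map (λ i → squareWeight (n ∸ i) i) suc (upTo n))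
                 (sum-applyUpTo (λ z → squareWeight (n ∸ suc z) (suc z)) (λ i → i) n) ⟩
    σ (λ z → squareWeight (n ∸ suc z) (suc z)) n
      ≈⟨ σ-cong n (λ z z<n → reflexive (row z z<n)) ⟩
    σ (λ z → oddLetterWeight n (n ∸ suc z)) n
      ≈⟨ σ-reverse (oddLetterWeight n) n ⟩
    oddWeight n ∎
    where
    exponent : ∀ n z → z < n → (if suc z ≡ᵇ 1 then 0 else 1) ≡ (if suc (n ∸ suc z) <ᵇ n then 1 else 0)
    exponent (suc n)       zero    _             =
      ≡.cong (λ b → if b then 1 else 0) (≡.sym (<ᵇ-false {suc n} ℕ.≤-refl))
    exponent (suc (suc n)) (suc z) (s≤s (s≤s _)) =
      ≡.cong (λ b → if b then 1 else 0) (≡.sym (<ᵇ-true (s≤s (s≤s (ℕ.m∸n≤m n z)))))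
    parity : ∀ b x → (if b then x else 0#) ≡ (if not b then 0# else x)
    parity true  x = ≡.refl
    parity false x = ≡.refl
    row : ∀ z → z < n → squareWeight (n ∸ suc z) (suc z) ≡ oddLetterWeight n (n ∸ suc z)
    row z z<n = ≡.trans (parity (evenᵇ (n ∸ suc z)) _)
                  (≡.cong₂ (λ b e → if b then 0# else mono (n ∸ suc z) e)
                           (≡.sym (evenᵇ-suc (n ∸ suc z))) (exponent n z z<n))

  -- r rooks on the board of length n weigh e_r(c_{n-1}, …, c_0): the first
  -- column of the board of length n + 1 has weight c_n, and its remaining
  -- columns are those of the board of length n.
  boardSum≈E : ∀ n r → esym (map (columnWeight n) (oneTo n)) r ≈ E n r
  boardSum≈E zero    r = refl
  boardSum≈E (suc n) r = begin
    esym (map (columnWeight (suc n)) (oneTo (suc n))) r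
      ≡⟨ ≡.cong (λ js → esym js r) columns ⟩
    esym (columnWeight (suc n) 1 ∷ map (λ j → columnWeight (suc n) (suc j)) (oneTo n)) r
      ≈⟨ esym-∷-cong {ds = map (λ j → columnWeight (suc n) (suc j)) (oneTo n)} {es = applyDownFrom oddWeight n}
           (trans (columnWeight≈columnSum (suc n) 1) (columnSum≈oddWeight n))
           (λ r′ → trans (esym-map-cong later-column (oneTo n) r′) (boardSum≈E n r′)) r ⟩
    E (suc n) r ∎
    where
    columns : map (columnWeight (suc n)) (oneTo (suc n))
              ≡ columnWeight (suc n) 1 ∷ map (λ j → columnWeight (suc n) (suc j)) (oneTo n)
    columns = ≡.cong (columnWeight (suc n) 1 ∷_)
                (≡.trans (≡.sym (List.map-∘ (applyUpTo suc n)))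
                         (≡.cong (map (λ j → columnWeight (suc n) (suc j))) (≡.sym (List.map-upTo suc n))))
    later-column : ∀ j → columnWeight (suc n) (suc j) ≈ columnWeight n j
    later-column j = trans (columnWeight≈columnSum (suc n) (suc j)) (sym (columnWeight≈columnSum n j))

  signedQT≡signed : ∀ e x → signedQT e x ≡ signed e x
  signedQT≡signed zero    x = ≡.refl
  signedQT≡signed (suc e) x = ≡.cong -_ (signedQT≡signed e x)

  𝒜ℛ-weight : ∀ n r → sumR (map (placementWeight n) (𝒜ℛ n r)) ≈ E n r
  𝒜ℛ-weight n r = begin
    sumR (map (placementWeight n) (𝒜ℛ n r))
      ≈⟨ sum-filter (placementWeight n) (λ T → length T ≡ᵇ r) (placementsCols n (oneTo n)) ⟩
    placementSum n (oneTo n) r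
      ≈⟨ placementSum≈esym n (oneTo n) r ⟩
    esym (map (columnWeight n) (oneTo n)) r
      ≈⟨ boardSum≈E n r ⟩
    E n r ∎

  sqt≈s : ∀ n k → sqt n k ≈ s n k
  sqt≈s zero    k = refl
  sqt≈s (suc n) k with k ≤ᵇ suc n in k≤ᵇ1+n
  ... | true  = begin
    signedQT (suc n ∸ k) (sumR (map (placementWeight (suc n)) (𝒜ℛ (suc n) (suc n ∸ k))))
      ≡⟨ signedQT≡signed (suc n ∸ k) _ ⟩
    signed (suc n ∸ k) (sumR (map (placementWeight (suc n)) (𝒜ℛ (suc n) (suc n ∸ k))))
      ≈⟨ signed-cong (suc n ∸ k) (𝒜ℛ-weight (suc n) (suc n ∸ k)) ⟩
    signed (suc n ∸ k) (E (suc n) (suc n ∸ k))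
      ≈⟨ s≈signedE {suc n} {k} (≤ᵇ-true⇒≤ k≤ᵇ1+n) ⟨
    s (suc n) k ∎
  ... | false = sym (s-vanish {suc n} {k} (≤ᵇ-false⇒> k≤ᵇ1+n))

-- Extend each sum down to k = 0 (the added terms vanish by triangularity),
-- replace S_{q,t} and s_{q,t} by S and s, and invert.
theorem9p4 : ∀ {c ℓ} (R : CommutativeRing c ℓ) (q t : CommutativeRing.Carrier R) (m n : ℕ) → m ≤ n →
  let open CommutativeRing R
      open QT R q t
  in (sumFromTo m n (λ k → sqt n k * Sqt k m) ≈ δ m n)
     × (sumFromTo m n (λ k → Sqt n k * sqt k m) ≈ δ m n)
theorem9p4 R q t m n m≤n = s-S , S-s
  where
  open CommutativeRing R hiding (zero)
  open QT R q t using (sqt; Sqt; sumFromTo; δ)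
  open Sums R using (σ; σ-cong; sum-from-to)
  open Weights R q t using (oddWeight)
  open Stirling R oddWeight using (S; s; S-vanish; s-vanish; s-S-inverse; S-s-inverse)
  open RGWords R q t using (Sqt≈S)
  open Rooks R q t using (sqt≈s)
  open import Relation.Binary.Reasoning.Setoid setoid

  s-S : sumFromTo m n (λ k → sqt n k * Sqt k m) ≈ δ m n
  s-S = begin
    sumFromTo m n (λ k → sqt n k * Sqt k m)
      ≈⟨ sum-from-to (λ k → sqt n k * Sqt k m) m n m≤n
                      (λ k k<m → trans (*-congˡ (trans (Sqt≈S k m) (S-vanish k<m))) (zeroʳ _)) ⟩
    σ (λ k → sqt n k * Sqt k m) (suc n)
      ≈⟨ σ-cong (suc n) (λ k _ → *-cong (sqt≈s n k) (Sqt≈S k m)) ⟩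
    σ (λ k → s n k * S k m) (suc n)
      ≈⟨ s-S-inverse n m ⟩
    δ m n ∎

  S-s : sumFromTo m n (λ k → Sqt n k * sqt k m) ≈ δ m n
  S-s = begin
    sumFromTo m n (λ k → Sqt n k * sqt k m)
      ≈⟨ sum-from-to (λ k → Sqt n k * sqt k m) m n m≤n
                      (λ k k<m → trans (*-congˡ (trans (sqt≈s k m) (s-vanish k<m))) (zeroʳ _)) ⟩
    σ (λ k → Sqt n k * sqt k m) (suc n)
      ≈⟨ σ-cong (suc n) (λ k _ → *-cong (Sqt≈S n k) (sqt≈s k m)) ⟩
    σ (λ k → S n k * s k m) (suc n)
      ≈⟨ S-s-inverse n m ⟩
    δ m n ∎
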